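{- Let $a$ be a weak composition of length $n$. Then $$\mathfrak L_a = \sum_{w \textrm{ is $a$-flag compatible}} x^{\mathrm{comp}(w)}.$$
   Context: $\mathfrak L_a$ is the fundamental particle (Searles): the generating function $\sum x^{\mathrm{wt}(T)}$ over fillings $T$ of the diagram of $a$ (row $i$ has $a_i$ left-justified boxes) such that rows weakly decrease left to right, the first entry of each row $i$ equals $i$, and whenever $i<j$ every entry of row $i$ is strictly smaller than every entry of row $j$. For a word $b=b_1\cdots b_p$, a word $w$ is $b$-compatible if $1\le w_1\le\cdots\le w_p\le n$, $w_k<w_{k+1}$ whenever $b_k<b_{k+1}$, and $w_k\le b_k$; $\mathrm{comp}(w)$ counts occurrences of each $i$ in $w$. Let $S=\{p_1,\ldots,p_k\}$ be the set of partial sums of the entries of $a$ (duplicates, arising from zero entries, removed). A compatible sequence $w$ for the word formed by writing $a_i$ copies of $i$ consecutively for $i=1,\ldots,n$ is $a$-flag compatible if for each $p_i\in S$ the letter in position $p_i$ of $w$ equals the row index of the $i$th nonzero entry of $a$. -}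

module Defs where

open import Data.Bool using (Bool; true; false; _∧_; if_then_else_)
open import Data.Nat using (ℕ; zero; suc; _+_; _≤ᵇ_; _<ᵇ_; _≡ᵇ_)
open import Data.List using (List; []; _∷_; map; concat; concatMap; upTo; filterᵇ; length)
open import Data.Vec using (Vec; toList)
open import Data.List.Relation.Binary.Permutation.Propositional using (_↭_)

-- A weak composition of length n is  a : Vec ℕ n ; rows are indexed 1..n.
-- Words / rows are lists of positive naturals; positions are 1-indexed.
-- A polynomial with nonnegative integer coefficients in x_1..x_n is
-- represented as the multiset (list up to permutation) of its monomials,
-- each monomial x^e given by its exponent vector e = (e_1,…,e_n) as a
-- list of length n.  Equality of such polynomials is _↭_.

Poly : Set
Poly = List (List ℕ)

range1 : ℕ → List ℕ
range1 n = map suc (upTo n)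

words : ℕ → ℕ → List (List ℕ)
words zero    n = [] ∷ []
words (suc k) n = concatMap (λ x → map (x ∷_) (words k n)) (range1 n)

occ : ℕ → List ℕ → ℕ
occ i []       = 0
occ i (x ∷ xs) = if x ≡ᵇ i then suc (occ i xs) else occ i xs

comp : ℕ → List ℕ → List ℕ
comp n w = map (λ i → occ i w) (range1 n)

-- Fillings of the diagram of a (row i has a_i boxes), entries in {1..n}.
-- (Every valid filling has entries in {1..n}: entries of row i are
--  ≤ its first entry i ≤ n, so this enumeration loses nothing.)

fillingCandidates : List ℕ → ℕ → List (List (List ℕ))
fillingCandidates []       n = [] ∷ []
fillingCandidates (k ∷ ks) n =
  concatMap (λ r → map (r ∷_) (fillingCandidates ks n)) (words k n)

weaklyDecreasing : List ℕ → Bool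
weaklyDecreasing []           = true
weaklyDecreasing (x ∷ [])     = true
weaklyDecreasing (x ∷ y ∷ xs) = (y ≤ᵇ x) ∧ weaklyDecreasing (y ∷ xs)

firstEntryIs : ℕ → List ℕ → Bool
firstEntryIs i []      = true
firstEntryIs i (x ∷ _) = x ≡ᵇ i

rowConditions : ℕ → List (List ℕ) → Bool
rowConditions i []       = true
rowConditions i (r ∷ rs) =
  weaklyDecreasing r ∧ firstEntryIs i r ∧ rowConditions (suc i) rs

all : {A : Set} → (A → Bool) → List A → Bool
all p []       = true
all p (x ∷ xs) = p x ∧ all p xs

rowsSeparated : List (List ℕ) → Bool
rowsSeparated []       = true
rowsSeparated (r ∷ rs) =
  all (λ x → all (λ y → x <ᵇ y) (concat rs)) r ∧ rowsSeparated rs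

isParticleFilling : List (List ℕ) → Bool
isParticleFilling T = rowConditions 1 T ∧ rowsSeparated T

fundamentalParticle : (n : ℕ) → Vec ℕ n → Poly
fundamentalParticle n a =
  map (λ T → comp n (concat T))
      (filterᵇ isParticleFilling (fillingCandidates (toList a) n))

blockWord : ℕ → List ℕ → List ℕ
blockWord i []       = []
blockWord i (k ∷ ks) = rep k
  where
  rep : ℕ → List ℕ
  rep zero    = blockWord (suc i) ks
  rep (suc m) = i ∷ rep m

-- w is b-compatible: 1 ≤ w_1 ≤ … ≤ w_p, w_k < w_{k+1} if b_k < b_{k+1},
-- w_k ≤ b_k, and w has the same length as b.  (w_p ≤ n holds for the
-- candidates enumerated below, which have letters in {1..n}.)
compatible : List ℕ → List ℕ → Bool
compatible []             []             = true
compatible (b ∷ [])       (w ∷ [])       = (1 ≤ᵇ w) ∧ (w ≤ᵇ b)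
compatible (b ∷ b' ∷ bs) (w ∷ w' ∷ ws) =
  (1 ≤ᵇ w) ∧ (w ≤ᵇ b) ∧ (w ≤ᵇ w')
  ∧ (if b <ᵇ b' then w <ᵇ w' else true)
  ∧ compatible (b' ∷ bs) (w' ∷ ws)
compatible _ _ = false

-- letter of w at (1-indexed) position s; 0 if there is none
letterAt : List ℕ → ℕ → ℕ
letterAt []       _             = 0
letterAt (x ∷ xs) zero          = 0
letterAt (x ∷ xs) (suc zero)    = x
letterAt (x ∷ xs) (suc (suc s)) = letterAt xs (suc s)

-- flag condition: for each row j with a_j ≠ 0, the letter of w in position
-- a_1 + … + a_j (the partial sum ending the block of the j-th row, i.e. the
-- element of S belonging to that nonzero entry) equals j.
-- Arguments: current row index j, partial sum so far, remaining entries.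
flagCondition : List ℕ → ℕ → ℕ → List ℕ → Bool
flagCondition w j acc []       = true
flagCondition w j acc (zero ∷ ks)  = flagCondition w (suc j) acc ks
flagCondition w j acc (suc k ∷ ks) =
  (letterAt w (acc + suc k) ≡ᵇ j) ∧ flagCondition w (suc j) (acc + suc k) ks

isFlagCompatible : (n : ℕ) → Vec ℕ n → List ℕ → Bool
isFlagCompatible n a w =
  compatible (blockWord 1 (toList a)) w ∧ flagCondition w 1 0 (toList a)

flagCompatibleSum : (n : ℕ) → Vec ℕ n → Poly
flagCompatibleSum n a =
  map (comp n)
      (filterᵇ (isFlagCompatible n a)
               (words (length (blockWord 1 (toList a))) n))

-- Read each row of a filling from right to left and concatenate: on the candidate fillings
-- of the diagram of a (rows of lengths a₁, …, aₙ with letters in 1..n) this reading word is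
-- a content-preserving bijection onto the words of length a₁ + ⋯ + aₙ.  Under it row i
-- faces the block of letters i of the word 1^a₁ ⋯ n^aₙ, so a weakly decreasing row headed
-- by i becomes a weakly increasing block bounded by i whose last letter, sitting at a
-- partial sum, is i: that is the flag condition.  Because every row starts with its index
-- and decreases, the rows are separated exactly when the first letter of each block
-- exceeds the index of the previous nonempty row, which is the strict ascent demanded
-- by compatibility where the block word ascends.

module Submission where

open import Data.Bool using (Bool; true; false; T; _∧_; if_then_else_)
open import Data.Bool.Properties using (T-∧)
open import Data.Empty using (⊥; ⊥-elim)
open import Data.Unit using (⊤; tt)
open import Data.Product using (_×_; _,_; proj₁; proj₂)
open import Data.Nat using (ℕ; zero; suc; _+_; _≤_; _<_; z≤n; s≤s; z<s; _≤ᵇ_; _<ᵇ_; _≡ᵇ_)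
open import Data.Nat.Properties
open import Data.Nat.ListAction using (sum)
open import Data.List
  using (List; []; _∷_; [_]; _++_; _∷ʳ_; map; concat; concatMap; upTo; filterᵇ; length; reverse; replicate)
open import Data.List.Properties
  using (map-id; map-cong; map-∘; ++-identityʳ; concatMap-cong; concatMap-map; concatMap-pure; map-concatMap; concatMap-++; unfold-reverse;
         ++-assoc; length-replicate; length-reverse)
open import Data.List.Relation.Binary.Permutation.Propositional
  using (_↭_; prep; ↭-refl; ↭-reflexive; ↭-sym; ↭-trans; module PermutationReasoning)
import Data.List.Relation.Binary.Permutation.Propositional as Perm
open import Data.List.Relation.Binary.Permutation.Propositional.Properties
  using (map⁺; ++⁺ˡ; ++⁺; shifts; filter-↭)
open import Data.List.Relation.Unary.All using (All; []; _∷_)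
import Data.List.Relation.Unary.All as All
import Data.List.Relation.Unary.All.Properties as All
open import Data.Vec using (Vec; toList)
open import Function using (_∘_; Equivalence)
open import Relation.Binary.PropositionalEquality using (_≡_; refl; sym; trans; cong; cong₂; subst; subst₂; module ≡-Reasoning)

open import Defs

concatMap-concatMap : {A B C : Set} (g : B → List C) (f : A → List B) (xs : List A) →
  concatMap g (concatMap f xs) ≡ concatMap (concatMap g ∘ f) xs
concatMap-concatMap g f []       = refl
concatMap-concatMap g f (x ∷ xs) =
  trans (concatMap-++ g (f x) (concatMap f xs)) (cong (concatMap g (f x) ++_) (concatMap-concatMap g f xs))

concatMap-cong-↭ : {A B : Set} {f g : A → List B} → (∀ x → f x ↭ g x) → (xs : List A) →
  concatMap f xs ↭ concatMap g xs
concatMap-cong-↭ f↭g []       = ↭-refl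
concatMap-cong-↭ f↭g (x ∷ xs) = ++⁺ (f↭g x) (concatMap-cong-↭ f↭g xs)

concatMap⁺ : {A B : Set} (f : A → List B) {xs ys : List A} → xs ↭ ys → concatMap f xs ↭ concatMap f ys
concatMap⁺ f Perm.refl         = ↭-refl
concatMap⁺ f (prep x p)        = ++⁺ˡ (f x) (concatMap⁺ f p)
concatMap⁺ f (Perm.swap x y p) = ↭-trans (shifts (f x) (f y)) (++⁺ˡ (f y) (++⁺ˡ (f x) (concatMap⁺ f p)))
concatMap⁺ f (Perm.trans p q)  = ↭-trans (concatMap⁺ f p) (concatMap⁺ f q)

concatMap-map-comm : {A B C : Set} (g : A → B → C) (xs : List A) (ys : List B) →
  concatMap (λ x → map (g x) ys) xs ↭ concatMap (λ y → map (λ x → g x y) xs) ys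
concatMap-map-comm g []       ys = ↭-reflexive (sym (concatMap-nil ys))
  where
  concatMap-nil : ∀ zs → concatMap (λ y → map (λ x → g x y) []) zs ≡ []
  concatMap-nil []       = refl
  concatMap-nil (_ ∷ zs) = concatMap-nil zs
concatMap-map-comm g (x ∷ xs) ys =
  ↭-trans (++⁺ˡ (map (g x) ys) (concatMap-map-comm g xs ys)) (↭-sym (concatMap-∷ ys))
  where
  concatMap-∷ : ∀ zs → concatMap (λ y → g x y ∷ map (λ x′ → g x′ y) xs) zs
                      ↭ map (g x) zs ++ concatMap (λ y → map (λ x′ → g x′ y) xs) zs
  concatMap-∷ []       = ↭-refl
  concatMap-∷ (y ∷ zs) =
    prep (g x y) (↭-trans (++⁺ˡ (map (λ x′ → g x′ y) xs) (concatMap-∷ zs)) (shifts (map (λ x′ → g x′ y) xs) (map (g x) zs)))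

map-filterᵇ : {A B : Set} (p : A → Bool) (q : B → Bool) (g : A → B) (xs : List A) →
  All (λ x → p x ≡ q (g x)) xs → map g (filterᵇ p xs) ≡ filterᵇ q (map g xs)
map-filterᵇ p q g []       []       = refl
map-filterᵇ p q g (x ∷ xs) (e ∷ es) with p x | q (g x) | e
... | true  | true  | refl = cong (g x ∷_) (map-filterᵇ p q g xs es)
... | false | false | refl = map-filterᵇ p q g xs es

lastOf : {A : Set} → A → List A → A
lastOf x []       = x
lastOf x (y ∷ ys) = lastOf y ys

All-lastOf : {A : Set} {P : A → Set} (x : A) (xs : List A) → All P (x ∷ xs) → P (lastOf x xs)
All-lastOf x []       (px ∷ _)  = px
All-lastOf x (y ∷ ys) (_ ∷ pys) = All-lastOf y ys pys

lastOf-∷ʳ : {A : Set} (x : A) (xs : List A) (y : A) → lastOf x (xs ∷ʳ y) ≡ y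
lastOf-∷ʳ x []       y = refl
lastOf-∷ʳ x (z ∷ zs) y = lastOf-∷ʳ z zs y

lastOf-replicate : {A : Set} (x : A) (m : ℕ) (y : A) → lastOf x (replicate (suc m) y) ≡ y
lastOf-replicate x zero    y = refl
lastOf-replicate x (suc m) y = lastOf-replicate y m y

lastOf-reverse : {A : Set} (x y : A) (ys : List A) → lastOf x (reverse (y ∷ ys)) ≡ y
lastOf-reverse x y ys = trans (cong (lastOf x) (unfold-reverse y ys)) (lastOf-∷ʳ x (reverse ys) y)

replicate-suc-∷ʳ : {A : Set} (m : ℕ) (y : A) → replicate (suc m) y ≡ replicate m y ∷ʳ y
replicate-suc-∷ʳ zero    y = refl
replicate-suc-∷ʳ (suc m) y = cong (y ∷_) (replicate-suc-∷ʳ m y)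

T-∧⁻ : ∀ {a b} → T (a ∧ b) → T a × T b
T-∧⁻ = Equivalence.to T-∧

T-∧⁺ : ∀ {a b} → T a → T b → T (a ∧ b)
T-∧⁺ p q = Equivalence.from T-∧ (p , q)

T-injective : ∀ {a b} → (T a → T b) → (T b → T a) → a ≡ b
T-injective {true}  {true}  _ _ = refl
T-injective {true}  {false} f _ = ⊥-elim (f tt)
T-injective {false} {true}  _ g = ⊥-elim (g tt)
T-injective {false} {false} _ _ = refl

T-all⁻ : {A : Set} (p : A → Bool) (xs : List A) → T (all p xs) → All (T ∘ p) xs
T-all⁻ p []       _ = []
T-all⁻ p (x ∷ xs) h = proj₁ (T-∧⁻ h) ∷ T-all⁻ p xs (proj₂ (T-∧⁻ {p x} h))

T-all⁺ : {A : Set} (p : A → Bool) (xs : List A) → All (T ∘ p) xs → T (all p xs)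
T-all⁺ p []       []       = tt
T-all⁺ p (x ∷ xs) (h ∷ hs) = T-∧⁺ h (T-all⁺ p xs hs)

-- Reading words

readingWord : List (List ℕ) → List ℕ
readingWord = concatMap reverse

module Enumeration (n : ℕ) where

  letters : List ℕ
  letters = range1 n

  words-+ : ∀ k m → words (k + m) n ≡ concatMap (λ u → map (u ++_) (words m n)) (words k n)
  words-+ zero    m = sym (trans (++-identityʳ (map ([] ++_) (words m n))) (map-id (words m n)))
  words-+ (suc k) m = begin
    concatMap (λ x → map (x ∷_) (words (k + m) n)) letters
      ≡⟨ concatMap-cong (λ x → cong (map (x ∷_)) (words-+ k m)) letters ⟩
    concatMap (λ x → map (x ∷_) (concatMap appendAll (words k n))) letters
      ≡⟨ concatMap-cong (λ x → trans (map-concatMap (x ∷_) appendAll (words k n))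
                                     (concatMap-cong (λ u → sym (map-∘ (words m n))) (words k n))) letters ⟩
    concatMap (λ x → concatMap (λ u → map (λ v → x ∷ (u ++ v)) (words m n)) (words k n)) letters
      ≡⟨ concatMap-cong (λ x → sym (concatMap-map appendAll (x ∷_) (words k n))) letters ⟩
    concatMap (λ x → concatMap appendAll (map (x ∷_) (words k n))) letters
      ≡⟨ concatMap-concatMap appendAll (λ x → map (x ∷_) (words k n)) letters ⟨
    concatMap appendAll (words (suc k) n) ∎
    where
    open ≡-Reasoning
    appendAll : List ℕ → List (List ℕ)
    appendAll u = map (u ++_) (words m n)

  words-1 : words 1 n ≡ map [_] letters
  words-1 = trans (sym (concatMap-map [_] [_] letters)) (concatMap-pure (map [_] letters))

  map-reverse-words : ∀ k → map reverse (words k n) ↭ words k n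
  map-reverse-words zero    = ↭-refl
  map-reverse-words (suc k) = begin
    map reverse (words (suc k) n)
      ≡⟨ map-concatMap reverse (λ x → map (x ∷_) (words k n)) letters ⟩
    concatMap (λ x → map reverse (map (x ∷_) (words k n))) letters
      ≡⟨ concatMap-cong (λ x → trans (sym (map-∘ (words k n)))
                                     (trans (map-cong (unfold-reverse x) (words k n)) (map-∘ (words k n)))) letters ⟩
    concatMap (λ x → map (_∷ʳ x) (map reverse (words k n))) letters
      ↭⟨ concatMap-cong-↭ (λ x → map⁺ (_∷ʳ x) (map-reverse-words k)) letters ⟩
    concatMap (λ x → map (_∷ʳ x) (words k n)) letters
      ↭⟨ concatMap-map-comm (λ x u → u ∷ʳ x) letters (words k n) ⟩
    concatMap (λ u → map (u ∷ʳ_) letters) (words k n)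
      ≡⟨ concatMap-cong (λ u → trans (map-∘ letters) (cong (map (u ++_)) (sym words-1))) (words k n) ⟩
    concatMap (λ u → map (u ++_) (words 1 n)) (words k n)
      ≡⟨ words-+ k 1 ⟨
    words (k + 1) n
      ≡⟨ cong (λ m → words m n) (+-comm k 1) ⟩
    words (suc k) n ∎
    where open PermutationReasoning

  map-readingWord-candidates : ∀ as → map readingWord (fillingCandidates as n) ↭ words (sum as) n
  map-readingWord-candidates []       = ↭-refl
  map-readingWord-candidates (k ∷ ks) = begin
    map readingWord (concatMap (λ r → map (r ∷_) (fillingCandidates ks n)) (words k n))
      ≡⟨ map-concatMap readingWord _ (words k n) ⟩
    concatMap (λ r → map readingWord (map (r ∷_) (fillingCandidates ks n))) (words k n)
      ≡⟨ concatMap-cong (λ r → trans (sym (map-∘ (fillingCandidates ks n))) (map-∘ (fillingCandidates ks n))) (words k n) ⟩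
    concatMap (λ r → map (reverse r ++_) (map readingWord (fillingCandidates ks n))) (words k n)
      ↭⟨ concatMap-cong-↭ (λ r → map⁺ (reverse r ++_) (map-readingWord-candidates ks)) (words k n) ⟩
    concatMap (λ r → map (reverse r ++_) (words (sum ks) n)) (words k n)
      ≡⟨ concatMap-map _ reverse (words k n) ⟨
    concatMap (λ r → map (r ++_) (words (sum ks) n)) (map reverse (words k n))
      ↭⟨ concatMap⁺ _ (map-reverse-words k) ⟩
    concatMap (λ r → map (r ++_) (words (sum ks) n)) (words k n)
      ≡⟨ words-+ k (sum ks) ⟨
    words (k + sum ks) n ∎
    where open PermutationReasoning

  words-shape : ∀ k → All (λ w → length w ≡ k × All (1 ≤_) w) (words k n)
  words-shape zero    = (refl , []) ∷ []
  words-shape (suc k) = All.concat⁺ (All.map⁺ (All.map⁺ (All.universal extend (upTo n))))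
    where
    extend : ∀ x → All (λ w → length w ≡ suc k × All (1 ≤_) w) (map (suc x ∷_) (words k n))
    extend x = All.map⁺ (All.map (λ (len , pos) → cong suc len , s≤s z≤n ∷ pos) (words-shape k))

  candidates-shape : ∀ as → All (λ Ts → map length Ts ≡ as × All (All (1 ≤_)) Ts) (fillingCandidates as n)
  candidates-shape []       = (refl , []) ∷ []
  candidates-shape (k ∷ ks) =
    All.concat⁺ (All.map⁺ (All.map (λ (len , pos) → All.map⁺ (All.map (λ (lens , poss) → cong₂ _∷_ len lens , pos ∷ poss)
                                                                      (candidates-shape ks)))
                                    (words-shape k)))

occ-++ : ∀ i u v → occ i (u ++ v) ≡ occ i u + occ i v
occ-++ i []      v = refl
occ-++ i (x ∷ u) v with x ≡ᵇ i
... | true  = cong suc (occ-++ i u v)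
... | false = occ-++ i u v

occ-reverse : ∀ i u → occ i (reverse u) ≡ occ i u
occ-reverse i []      = refl
occ-reverse i (x ∷ u) = begin
  occ i (reverse (x ∷ u))       ≡⟨ cong (occ i) (unfold-reverse x u) ⟩
  occ i (reverse u ++ [ x ])    ≡⟨ occ-++ i (reverse u) [ x ] ⟩
  occ i (reverse u) + occ i [ x ] ≡⟨ cong (_+ occ i [ x ]) (occ-reverse i u) ⟩
  occ i u + occ i [ x ]         ≡⟨ +-comm (occ i u) (occ i [ x ]) ⟩
  occ i [ x ] + occ i u         ≡⟨ occ-++ i [ x ] u ⟨
  occ i (x ∷ u)                 ∎
  where open ≡-Reasoning

occ-readingWord : ∀ i Ts → occ i (readingWord Ts) ≡ occ i (concat Ts)
occ-readingWord i []       = refl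
occ-readingWord i (r ∷ Ts) = begin
  occ i (reverse r ++ readingWord Ts)     ≡⟨ occ-++ i (reverse r) (readingWord Ts) ⟩
  occ i (reverse r) + occ i (readingWord Ts) ≡⟨ cong₂ _+_ (occ-reverse i r) (occ-readingWord i Ts) ⟩
  occ i r + occ i (concat Ts)             ≡⟨ occ-++ i r (concat Ts) ⟨
  occ i (r ++ concat Ts)                  ∎
  where open ≡-Reasoning

comp-readingWord : ∀ n Ts → comp n (readingWord Ts) ≡ comp n (concat Ts)
comp-readingWord n Ts = map-cong (λ i → occ-readingWord i Ts) (range1 n)

-- Particle fillings row by row

weaklyDecreasing⇒≤head : ∀ x r → T (weaklyDecreasing (x ∷ r)) → All (_≤ x) (x ∷ r)
weaklyDecreasing⇒≤head x []      _ = ≤-refl ∷ []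
weaklyDecreasing⇒≤head x (y ∷ r) h with y≤x , h ← T-∧⁻ h =
  ≤-refl ∷ All.map (λ z≤y → ≤-trans z≤y (≤ᵇ⇒≤ y x y≤x)) (weaklyDecreasing⇒≤head y r h)

weaklyDecreasing⇒lastOf≤ : ∀ x r → T (weaklyDecreasing (x ∷ r)) → All (lastOf x r ≤_) (x ∷ r)
weaklyDecreasing⇒lastOf≤ x []      _ = ≤-refl ∷ []
weaklyDecreasing⇒lastOf≤ x (y ∷ r) h
  with y≤x , h ← T-∧⁻ h
  with last≤y ∷ last≤r ← weaklyDecreasing⇒lastOf≤ y r h
  = ≤-trans last≤y (≤ᵇ⇒≤ y x y≤x) ∷ last≤y ∷ last≤r

-- lo is the index of the nearest nonempty row above (0 if there is none).  Since every
-- row starts with its index and decreases, rows are separated as soon as the last entry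
-- of each nonempty row exceeds lo.
ParticleRows : ℕ → ℕ → List (List ℕ) → Set
ParticleRows i lo []             = ⊤
ParticleRows i lo ([] ∷ Ts)      = ParticleRows (suc i) lo Ts
ParticleRows i lo ((x ∷ r) ∷ Ts) =
  T (weaklyDecreasing (x ∷ r)) × x ≡ i × lo < lastOf x r × ParticleRows (suc i) i Ts

rowConditions⇒ParticleRows : ∀ i lo Ts → T (rowConditions i Ts) → T (rowsSeparated Ts) →
  All (lo <_) (concat Ts) → ParticleRows i lo Ts
rowConditions⇒ParticleRows i lo []             _  _  _   = tt
rowConditions⇒ParticleRows i lo ([] ∷ Ts)      rc rs lo< = rowConditions⇒ParticleRows (suc i) lo Ts rc rs lo<
rowConditions⇒ParticleRows i lo ((x ∷ r) ∷ Ts) rc rs lo<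
  with decreasing , rc ← T-∧⁻ {weaklyDecreasing (x ∷ r)} rc
  with x≡ᵇi , rc ← T-∧⁻ rc
  with separated , rs ← T-∧⁻ rs
  with refl ← ≡ᵇ⇒≡ x i x≡ᵇi
  = decreasing , refl , All-lastOf x r (All.++⁻ˡ (x ∷ r) lo<)
  , rowConditions⇒ParticleRows (suc x) x Ts rc rs
      (All.map (λ {z} → <ᵇ⇒< x z) (T-all⁻ (x <ᵇ_) (concat Ts) (proj₁ (T-∧⁻ separated))))

ParticleRows⇒rowConditions : ∀ i lo Ts → ParticleRows i lo Ts →
  T (rowConditions i Ts) × T (rowsSeparated Ts) × All (lo <_) (concat Ts)
ParticleRows⇒rowConditions i lo []             _    = tt , tt , []
ParticleRows⇒rowConditions i lo ([] ∷ Ts)      rows = ParticleRows⇒rowConditions (suc i) lo Ts rows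
ParticleRows⇒rowConditions i lo ((x ∷ r) ∷ Ts) (decreasing , refl , lo<last , rows)
  with rc , rs , x< ← ParticleRows⇒rowConditions (suc x) x Ts rows =
  let last≤ = weaklyDecreasing⇒lastOf≤ x r decreasing
      separated = λ {y} y≤x → T-all⁺ (y <ᵇ_) (concat Ts) (All.map (λ x<z → <⇒<ᵇ (≤-<-trans y≤x x<z)) x<)
  in T-∧⁺ decreasing (T-∧⁺ (≡⇒≡ᵇ x x refl) rc)
   , T-∧⁺ (T-all⁺ _ (x ∷ r) (All.map separated (weaklyDecreasing⇒≤head x r decreasing))) rs
   , All.++⁺ (All.map (<-≤-trans lo<last) last≤)
             (All.map (<-trans (<-≤-trans lo<last (All.head last≤))) x<)

-- Flag-compatible words block by block

-- pb and pw are the letters of b and w just before the given suffixes (0 at the start).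
CompatibleAfter : ℕ → ℕ → List ℕ → List ℕ → Set
CompatibleAfter pb pw []       []       = ⊤
CompatibleAfter pb pw (b ∷ bs) (w ∷ ws) =
  pw ≤ w × (pb < b → pw < w) × 1 ≤ w × w ≤ b × CompatibleAfter b w bs ws
CompatibleAfter pb pw _        _        = ⊥

T-if-<ᵇ⁻ : ∀ b b′ w w′ → T (if b <ᵇ b′ then w <ᵇ w′ else true) → b < b′ → w < w′
T-if-<ᵇ⁻ b b′ w w′ h b<b′ with b <ᵇ b′ | <⇒<ᵇ b<b′
... | true | _ = <ᵇ⇒< w w′ h

T-if-<ᵇ⁺ : ∀ b b′ w w′ → (b < b′ → w < w′) → T (if b <ᵇ b′ then w <ᵇ w′ else true)
T-if-<ᵇ⁺ b b′ w w′ strict with b <ᵇ b′ in eq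
... | true  = <⇒<ᵇ (strict (<ᵇ⇒< b b′ (subst T (sym eq) tt)))
... | false = tt

compatible-∷⁻ : ∀ b w bs ws → T (compatible (b ∷ bs) (w ∷ ws)) → 1 ≤ w × w ≤ b × CompatibleAfter b w bs ws
compatible-∷⁻ b w []        []        h with 1≤w , w≤b ← T-∧⁻ h = ≤ᵇ⇒≤ 1 w 1≤w , ≤ᵇ⇒≤ w b w≤b , tt
compatible-∷⁻ b w (b′ ∷ bs) (w′ ∷ ws) h
  with 1≤w , h ← T-∧⁻ h
  with w≤b , h ← T-∧⁻ h
  with w≤w′ , h ← T-∧⁻ h
  with strict , h ← T-∧⁻ h
  = ≤ᵇ⇒≤ 1 w 1≤w , ≤ᵇ⇒≤ w b w≤b , ≤ᵇ⇒≤ w w′ w≤w′ , T-if-<ᵇ⁻ b b′ w w′ strict , compatible-∷⁻ b′ w′ bs ws h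

compatible-∷⁺ : ∀ b w bs ws → 1 ≤ w → w ≤ b → CompatibleAfter b w bs ws → T (compatible (b ∷ bs) (w ∷ ws))
compatible-∷⁺ b w []        []        1≤w w≤b _ = T-∧⁺ (≤⇒≤ᵇ 1≤w) (≤⇒≤ᵇ w≤b)
compatible-∷⁺ b w (b′ ∷ bs) (w′ ∷ ws) 1≤w w≤b (w≤w′ , strict , 1≤w′ , w′≤b′ , rest) =
  T-∧⁺ (≤⇒≤ᵇ 1≤w) (T-∧⁺ (≤⇒≤ᵇ w≤b) (T-∧⁺ (≤⇒≤ᵇ w≤w′)
    (T-∧⁺ (T-if-<ᵇ⁺ b b′ w w′ strict) (compatible-∷⁺ b′ w′ bs ws 1≤w′ w′≤b′ rest))))

compatible⇒CompatibleAfter : ∀ bs ws → T (compatible bs ws) → CompatibleAfter 0 0 bs ws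
compatible⇒CompatibleAfter []       []       _ = tt
compatible⇒CompatibleAfter (b ∷ bs) (w ∷ ws) h with 1≤w , w≤b , rest ← compatible-∷⁻ b w bs ws h =
  z≤n , (λ _ → 1≤w) , 1≤w , w≤b , rest
compatible⇒CompatibleAfter []          (_ ∷ _) ()
compatible⇒CompatibleAfter (_ ∷ [])    []      ()
compatible⇒CompatibleAfter (_ ∷ _ ∷ _) []      ()

CompatibleAfter⇒compatible : ∀ bs ws → CompatibleAfter 0 0 bs ws → T (compatible bs ws)
CompatibleAfter⇒compatible []       []       _                            = tt
CompatibleAfter⇒compatible (b ∷ bs) (w ∷ ws) (_ , _ , 1≤w , w≤b , rest) = compatible-∷⁺ b w bs ws 1≤w w≤b rest

CompatibleAfter-++⁻ : ∀ pb pw bs ws bs′ ws′ → length bs ≡ length ws →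
  CompatibleAfter pb pw (bs ++ bs′) (ws ++ ws′) →
  CompatibleAfter pb pw bs ws × CompatibleAfter (lastOf pb bs) (lastOf pw ws) bs′ ws′
CompatibleAfter-++⁻ pb pw []       []       bs′ ws′ _  h = tt , h
CompatibleAfter-++⁻ pb pw (b ∷ bs) (w ∷ ws) bs′ ws′ eq (w≥ , strict , 1≤w , w≤b , rest)
  with front , back ← CompatibleAfter-++⁻ b w bs ws bs′ ws′ (suc-injective eq) rest =
  (w≥ , strict , 1≤w , w≤b , front) , back

CompatibleAfter-++⁺ : ∀ pb pw bs ws bs′ ws′ → length bs ≡ length ws →
  CompatibleAfter pb pw bs ws → CompatibleAfter (lastOf pb bs) (lastOf pw ws) bs′ ws′ →
  CompatibleAfter pb pw (bs ++ bs′) (ws ++ ws′)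
CompatibleAfter-++⁺ pb pw []       []       bs′ ws′ _  _ back = back
CompatibleAfter-++⁺ pb pw (b ∷ bs) (w ∷ ws) bs′ ws′ eq (w≥ , strict , 1≤w , w≤b , front) back =
  w≥ , strict , 1≤w , w≤b , CompatibleAfter-++⁺ b w bs ws bs′ ws′ (suc-injective eq) front back

letterAt-++-∷ : ∀ u x v → letterAt (u ++ x ∷ v) (suc (length u)) ≡ x
letterAt-++-∷ []      x v = refl
letterAt-++-∷ (_ ∷ u) x v = letterAt-++-∷ u x v

letterAt-++ : ∀ u v s → letterAt (u ++ v) (length u + suc s) ≡ letterAt v (suc s)
letterAt-++ []      v s = refl
letterAt-++ (x ∷ u) v s = begin
  letterAt (x ∷ u ++ v) (suc (length u + suc s))     ≡⟨ cong (letterAt (x ∷ u ++ v) ∘ suc) (+-suc (length u) s) ⟩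
  letterAt (u ++ v) (suc (length u + s))             ≡⟨ cong (letterAt (u ++ v)) (+-suc (length u) s) ⟨
  letterAt (u ++ v) (length u + suc s)               ≡⟨ letterAt-++ u v s ⟩
  letterAt v (suc s)                                 ∎
  where open ≡-Reasoning

flagCondition-++ : ∀ u v j acc ks → flagCondition (u ++ v) j (length u + acc) ks ≡ flagCondition v j acc ks
flagCondition-++ u v j acc []           = refl
flagCondition-++ u v j acc (zero ∷ ks)  = flagCondition-++ u v (suc j) acc ks
flagCondition-++ u v j acc (suc k ∷ ks)
  rewrite +-assoc (length u) acc (suc k) | +-suc acc k | letterAt-++ u v (acc + k)
        | flagCondition-++ u v (suc j) (suc (acc + k)) ks = refl

letterAt-endOfRow : ∀ x r v → letterAt (reverse (x ∷ r) ++ v) (suc (length r)) ≡ x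
letterAt-endOfRow x r v
  rewrite unfold-reverse x r | ++-assoc (reverse r) [ x ] v | sym (length-reverse r) = letterAt-++-∷ (reverse r) x v

flagCondition-afterRow : ∀ x r v j ks →
  flagCondition (reverse (x ∷ r) ++ v) j (suc (length r)) ks ≡ flagCondition v j 0 ks
flagCondition-afterRow x r v j ks =
  subst (λ m → flagCondition (reverse (x ∷ r) ++ v) j m ks ≡ flagCondition v j 0 ks)
        (trans (+-identityʳ _) (length-reverse (x ∷ r))) (flagCondition-++ (reverse (x ∷ r)) v j 0 ks)

blockWord-∷ : ∀ i m ks → blockWord i (m ∷ ks) ≡ replicate m i ++ blockWord (suc i) ks
blockWord-∷ i zero    ks = refl
blockWord-∷ i (suc m) ks = cong (i ∷_) (blockWord-∷ i m ks)

length-blockWord : ∀ i as → length (blockWord i as) ≡ sum as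
length-blockWord i []           = refl
length-blockWord i (zero ∷ ks)  = length-blockWord (suc i) ks
length-blockWord i (suc k ∷ ks) = cong suc (length-blockWord i (k ∷ ks))

length-replicate-reverse : {A : Set} (i x : A) (r : List A) →
  length (replicate (suc (length r)) i) ≡ length (reverse (x ∷ r))
length-replicate-reverse i x r = trans (length-replicate (suc (length r))) (sym (length-reverse (x ∷ r)))

rowBlock⁻ : ∀ i lo x r → lo < i →
  CompatibleAfter lo lo (replicate (suc (length r)) i) (reverse (x ∷ r)) →
  T (weaklyDecreasing (x ∷ r)) × lo < lastOf x r
rowBlock⁻ i lo x []      lo<i (_ , lo<x , _) = tt , lo<x lo<i
rowBlock⁻ i lo x (y ∷ r) lo<i h
  with front , (y≤x , _) ← CompatibleAfter-++⁻ lo lo _ _ [ i ] [ x ] (length-replicate-reverse i y r)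
                             (subst₂ (CompatibleAfter lo lo) (replicate-suc-∷ʳ (suc (length r)) i)
                                     (unfold-reverse x (y ∷ r)) h)
  with decreasing , lo<last ← rowBlock⁻ i lo y r lo<i front
  = T-∧⁺ (≤⇒≤ᵇ (subst (_≤ x) (lastOf-reverse lo y r) y≤x)) decreasing , lo<last

rowBlock⁺ : ∀ i lo x r → x ≤ i → All (1 ≤_) (x ∷ r) → T (weaklyDecreasing (x ∷ r)) → lo < lastOf x r →
  CompatibleAfter lo lo (replicate (suc (length r)) i) (reverse (x ∷ r))
rowBlock⁺ i lo x []      x≤i (1≤x ∷ _) _ lo<x = <⇒≤ lo<x , (λ _ → lo<x) , 1≤x , x≤i , tt
rowBlock⁺ i lo x (y ∷ r) x≤i (1≤x ∷ pos) decreasing lo<last with y≤x , decreasing ← T-∧⁻ decreasing =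
  subst₂ (CompatibleAfter lo lo) (sym (replicate-suc-∷ʳ (suc (length r)) i)) (sym (unfold-reverse x (y ∷ r)))
    (CompatibleAfter-++⁺ lo lo _ _ [ i ] [ x ] (length-replicate-reverse i y r)
      (rowBlock⁺ i lo y r (≤-trans (≤ᵇ⇒≤ y x y≤x) x≤i) pos decreasing lo<last)
      ( subst (_≤ x) (sym (lastOf-reverse lo y r)) (≤ᵇ⇒≤ y x y≤x)
      , (λ i<i → ⊥-elim (<-irrefl (lastOf-replicate lo (length r) i) i<i))
      , 1≤x , x≤i , tt))

flagCompatible⇒ParticleRows : ∀ i lo Ts → lo < i → All (All (1 ≤_)) Ts →
  T (flagCondition (readingWord Ts) i 0 (map length Ts)) →
  CompatibleAfter lo lo (blockWord i (map length Ts)) (readingWord Ts) → ParticleRows i lo Ts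
flagCompatible⇒ParticleRows i lo []             _    _         _    _      = tt
flagCompatible⇒ParticleRows i lo ([] ∷ Ts)      lo<i (_ ∷ pos) flag compat =
  flagCompatible⇒ParticleRows (suc i) lo Ts (m<n⇒m<1+n lo<i) pos flag compat
flagCompatible⇒ParticleRows i lo ((x ∷ r) ∷ Ts) lo<i (_ ∷ pos) flag compat
  with atEnd , flag ← T-∧⁻ flag
  with refl ← ≡ᵇ⇒≡ x i (subst (λ z → T (z ≡ᵇ i)) (letterAt-endOfRow x r (readingWord Ts)) atEnd)
  with row , rest ← CompatibleAfter-++⁻ lo lo _ (reverse (x ∷ r)) _ (readingWord Ts) (length-replicate-reverse x x r)
                      (subst (λ bs → CompatibleAfter lo lo bs (reverse (x ∷ r) ++ readingWord Ts))
                             (blockWord-∷ x (suc (length r)) (map length Ts)) compat)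
  with decreasing , lo<last ← rowBlock⁻ x lo x r lo<i row
  = decreasing , refl , lo<last
  , flagCompatible⇒ParticleRows (suc x) x Ts (n<1+n x) pos
      (subst T (flagCondition-afterRow x r (readingWord Ts) (suc x) (map length Ts)) flag)
      (subst₂ (λ pb pw → CompatibleAfter pb pw _ _) (lastOf-replicate lo (length r) x) (lastOf-reverse lo x r) rest)

ParticleRows⇒flagCompatible : ∀ i lo Ts → lo < i → All (All (1 ≤_)) Ts → ParticleRows i lo Ts →
  T (flagCondition (readingWord Ts) i 0 (map length Ts)) ×
  CompatibleAfter lo lo (blockWord i (map length Ts)) (readingWord Ts)
ParticleRows⇒flagCompatible i lo []             _    _         _    = tt , tt
ParticleRows⇒flagCompatible i lo ([] ∷ Ts)      lo<i (_ ∷ pos) rows =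
  ParticleRows⇒flagCompatible (suc i) lo Ts (m<n⇒m<1+n lo<i) pos rows
ParticleRows⇒flagCompatible i lo ((x ∷ r) ∷ Ts) lo<i (1≤ ∷ pos) (decreasing , refl , lo<last , rows)
  with flag , compat ← ParticleRows⇒flagCompatible (suc x) x Ts (n<1+n x) pos rows
  = T-∧⁺ (≡⇒≡ᵇ _ _ (letterAt-endOfRow x r (readingWord Ts)))
         (subst T (sym (flagCondition-afterRow x r (readingWord Ts) (suc x) (map length Ts))) flag)
  , subst (λ bs → CompatibleAfter lo lo bs (reverse (x ∷ r) ++ readingWord Ts))
          (sym (blockWord-∷ x (suc (length r)) (map length Ts)))
      (CompatibleAfter-++⁺ lo lo _ (reverse (x ∷ r)) _ (readingWord Ts) (length-replicate-reverse x x r)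
        (rowBlock⁺ x lo x r ≤-refl 1≤ decreasing lo<last)
        (subst₂ (λ pb pw → CompatibleAfter pb pw _ _)
                (sym (lastOf-replicate lo (length r) x)) (sym (lastOf-reverse lo x r)) compat))

isFlagCompatibleFor : List ℕ → List ℕ → Bool
isFlagCompatibleFor as w = compatible (blockWord 1 as) w ∧ flagCondition w 1 0 as

isParticleFilling≡flagCompatible : ∀ Ts → All (All (1 ≤_)) Ts →
  isParticleFilling Ts ≡ isFlagCompatibleFor (map length Ts) (readingWord Ts)
isParticleFilling≡flagCompatible Ts pos = T-injective particle⇒flag flag⇒particle
  where
  particle⇒flag : T (isParticleFilling Ts) → T (isFlagCompatibleFor (map length Ts) (readingWord Ts))
  particle⇒flag h
    with rc , rs ← T-∧⁻ h
    with flag , compat ← ParticleRows⇒flagCompatible 1 0 Ts z<s pos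
                           (rowConditions⇒ParticleRows 1 0 Ts rc rs (All.concat⁺ pos))
    = T-∧⁺ (CompatibleAfter⇒compatible _ _ compat) flag

  flag⇒particle : T (isFlagCompatibleFor (map length Ts) (readingWord Ts)) → T (isParticleFilling Ts)
  flag⇒particle h
    with compat , flag ← T-∧⁻ h
    with rc , rs , _ ← ParticleRows⇒rowConditions 1 0 Ts
                         (flagCompatible⇒ParticleRows 1 0 Ts z<s pos flag (compatible⇒CompatibleAfter _ _ compat))
    = T-∧⁺ rc rs

candidates-isParticleFilling≡flagCompatible : ∀ n as →
  All (λ Ts → isParticleFilling Ts ≡ isFlagCompatibleFor as (readingWord Ts)) (fillingCandidates as n)
candidates-isParticleFilling≡flagCompatible n as =
  All.map (λ { {Ts} (refl , pos) → isParticleFilling≡flagCompatible Ts pos }) (Enumeration.candidates-shape n as)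

mainTheorem12 : (n : ℕ) (a : Vec ℕ n) →
                  fundamentalParticle n a ↭ flagCompatibleSum n a
mainTheorem12 n a = begin
  map (comp n ∘ concat) (filterᵇ isParticleFilling candidates)
    ≡⟨ map-cong (comp-readingWord n) _ ⟨
  map (comp n ∘ readingWord) (filterᵇ isParticleFilling candidates)
    ≡⟨ map-∘ _ ⟩
  map (comp n) (map readingWord (filterᵇ isParticleFilling candidates))
    ≡⟨ cong (map (comp n)) (map-filterᵇ _ _ readingWord candidates
                              (candidates-isParticleFilling≡flagCompatible n (toList a))) ⟩
  map (comp n) (filterᵇ (isFlagCompatible n a) (map readingWord candidates))
    ↭⟨ map⁺ (comp n) (filter-↭ _ (map-readingWord-candidates (toList a))) ⟩
  map (comp n) (filterᵇ (isFlagCompatible n a) (words (sum (toList a)) n))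
    ≡⟨ cong (λ m → map (comp n) (filterᵇ (isFlagCompatible n a) (words m n))) (length-blockWord 1 (toList a)) ⟨
  flagCompatibleSum n a ∎
  where
  open PermutationReasoning
  open Enumeration n
  candidates : List (List (List ℕ))
  candidates = fillingCandidates (toList a) n
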